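{- Let $\Sigma$ be a finite totally ordered alphabet and let $\prec$ denote $V$-order on $\Sigma^*$. For any strings $\mathbf{u},\mathbf{v},\mathbf{x},\mathbf{y}\in\Sigma^*$, $$\mathbf{x}\prec\mathbf{y}\iff \mathbf{u}\mathbf{x}\mathbf{v}\prec\mathbf{u}\mathbf{y}\mathbf{v}.$$
   Context: $\Sigma^*$ denotes the set of all finite strings over $\Sigma$, including the empty string $\varepsilon$. For a nonempty string $\mathbf{x}=x_1x_2\cdots x_n$, define $h\in\{1,\ldots,n\}$ by $h=1$ if $x_1\le x_2\le\cdots\le x_n$, and otherwise as the unique index with $x_{h-1}>x_h\le x_{h+1}\le\cdots\le x_n$; let $\mathbf{x}^*$ be the string obtained from $\mathbf{x}$ by deleting the letter $x_h$. Write $\mathbf{x}^{s*}$ for the result of applying $^*$ $s$ times ($\mathbf{x}^{0*}=\mathbf{x}$); the sequence $\mathbf{x},\mathbf{x}^*,\mathbf{x}^{2*},\ldots$ ends with $\varepsilon$. $V$-order $\prec$ is defined for distinct strings $\mathbf{x},\mathbf{y}$ as follows: $\mathbf{x}\prec\mathbf{y}$ if $\mathbf{x}$ occurs in the sequence $\mathbf{y},\mathbf{y}^*,\mathbf{y}^{2*},\ldots,\varepsilon$. If neither string occurs in the other's sequence, there are smallest $s,t\ge 0$ with $\mathbf{x}^{(s+1)*}=\mathbf{y}^{(t+1)*}$; put $\mathbf{s}=\mathbf{x}^{s*}$, $\mathbf{t}=\mathbf{y}^{t*}$, which are distinct strings of equal length $m$; let $j\in\{1,\ldots,m\}$ be the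 largest index with $\mathbf{s}[j]\ne\mathbf{t}[j]$; then $\mathbf{x}\prec\mathbf{y}$ iff $\mathbf{s}[j]<\mathbf{t}[j]$ in $\Sigma$. This is a strict total order on $\Sigma^*$. -}

module Defs where

open import Level using (Level)
open import Data.Nat using (ℕ; zero; suc; _≤_)
open import Data.Bool using (Bool; true; false; if_then_else_)
open import Data.List using (List; []; _∷_; _++_; length)
open import Data.Product using (_×_; ∃; ∃-syntax; Σ-syntax)
open import Data.Sum using (_⊎_)
open import Relation.Nullary using (¬_)
open import Relation.Binary using (Rel; IsStrictTotalOrder; tri<; tri≈; tri>)
open import Relation.Binary.PropositionalEquality using (_≡_; _≢_)

module VOrder {a ℓ : Level} {A : Set a} {_<_ : Rel A ℓ}
              (sto : IsStrictTotalOrder _≡_ _<_) where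

  open IsStrictTotalOrder sto using (compare)

  leq : A → A → Bool
  leq x y with compare x y
  ... | tri< _ _ _ = true
  ... | tri≈ _ _ _ = true
  ... | tri> _ _ _ = false

  nondec : List A → Bool
  nondec []           = true
  nondec (x ∷ [])     = true
  nondec (x ∷ y ∷ xs) = if leq x y then nondec (y ∷ xs) else false

  -- x* : delete the letter x_h, where h = 1 if x is nondecreasing, and
  -- otherwise h is the unique index with x_{h-1} > x_h ≤ x_{h+1} ≤ ⋯ ≤ x_n.
  -- (Recursively: if x ∷ xs is nondecreasing, h = 1; otherwise h ≥ 2 and
  -- x_h is the letter deleted from xs.)  The value on ε is irrelevant.
  star : List A → List A
  star []       = []
  star (x ∷ xs) = if nondec (x ∷ xs) then xs else x ∷ star xs

  iter : ℕ → List A → List A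
  iter zero    w = w
  iter (suc s) w = star (iter s w)

  Occurs : List A → List A → Set a
  Occurs x y = ∃[ s ] (iter s y ≡ x)

  MinMeet : List A → List A → ℕ → ℕ → Set a
  MinMeet x y s t =
    iter (suc s) x ≡ iter (suc t) y ×
    (∀ s' t' → iter (suc s') x ≡ iter (suc t') y → s ≤ s' × t ≤ t')

  -- the letters at the largest index j where the equal-length strings
  -- s and t differ satisfy s[j] < t[j]: s = p a w, t = q b w, |p| = |q|, a < b
  LastDiffLess : List A → List A → Set (a Level.⊔ ℓ)
  LastDiffLess s t =
    ∃[ p ] ∃[ q ] ∃[ c ] ∃[ d ] ∃[ w ]
      (s ≡ p ++ c ∷ w × t ≡ q ++ d ∷ w × length p ≡ length q × c < d)

  _≺_ : List A → List A → Set (a Level.⊔ ℓ)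
  x ≺ y = x ≢ y ×
    (Occurs x y ⊎
     (¬ Occurs x y × ¬ Occurs y x ×
      ∃[ s ] ∃[ t ] (MinMeet x y s t × LastDiffLess (iter s x) (iter t y))))

-- V-order is a lexicographic order in disguise.  Let chain x be the sequence
-- x^{(n-1)*}, …, x^{2*}, x^*, x of the nonempty iterates of star (n = |x|), and put x ⊏ y
-- when chain x precedes chain y lexicographically, the terms being compared
-- colexicographically.  Either chain x is a prefix of chain y, and then x occurs in the
-- sequence of y, or the chains first differ at terms x^{s*} and y^{t*} with a common star,
-- which is exactly the minimal meeting point in the definition of ≺; so ⊏ is V-order.
-- For ⊏, comparing a x with a y (or x b with y b) reduces, according to whether star
-- deletes the added letter, to comparing x, y, their stars, or strings differing in one
-- letter, so an induction on |x| + |y| shows that ⊏ is preserved by adding a letter on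
-- either side.  Being a strict total order, ⊏ is then also reflected.

module Submission where

open import Defs
open import Level using (Level; _⊔_)
open import Function.Base using (_∘_)
open import Function.Bundles using (_⇔_; _↔_; mk⇔)
open import Data.Fin using (Fin)
open import Data.Nat using (ℕ; zero; suc; pred; _+_; _∸_; _≤_; z≤n; s≤s) renaming (_<_ to _<ℕ_)
import Data.Nat.Properties as ℕ
open import Data.List using (List; []; _∷_; [_]; _++_; _∷ʳ_; length; reverse; initLast; _∷ʳ′_)
open import Data.List.Properties
  using (length-++; ++-assoc; ++-identityʳ; ∷ʳ-injective; ∷ʳ-injectiveˡ;
         length-++-sucʳ; reverse-++; unfold-reverse; reverse-injective; reverse-involutive; length-reverse)
open import Data.List.Relation.Binary.Lex.Core using (base; halt; this; next)
open import Data.List.Relation.Binary.Lex.Strict using (Lex-<; <-irreflexive; <-transitive; <-compare)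
open import Data.List.Relation.Binary.Pointwise using (≡⇒Pointwise-≡; Pointwise-≡⇒≡)
open import Data.Bool using (Bool; true; false; not; _∧_; if_then_else_)
open import Data.Bool.Properties using (∧-zeroʳ; ∧-identityʳ; not-injective)
open import Data.Product using (_×_; _,_; proj₁; proj₂; ∃; ∃-syntax)
open import Data.Sum using (_⊎_; inj₁; inj₂)
open import Data.Empty using (⊥; ⊥-elim)
open import Relation.Nullary using (¬_; yes; no)
open import Relation.Binary using (Rel; IsStrictPartialOrder; IsStrictTotalOrder; Tri; tri<; tri≈; tri>)
import Relation.Binary.Construct.StrictToNonStrict as NonStrict
open import Relation.Binary.PropositionalEquality
  using (_≡_; refl; sym; trans; cong; cong₂; subst; subst₂; resp₂; isEquivalence; module ≡-Reasoning)

private variable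
  ℓ₁ ℓ₂ ℓ₃ ℓ₄ : Level

module _ {B : Set ℓ₁} {_<_ : Rel B ℓ₂} (<-sto : IsStrictTotalOrder _≡_ _<_) where
  open IsStrictTotalOrder <-sto using (irrefl; compare) renaming (trans to <-trans)

  pullback-isStrictTotalOrder : {C : Set ℓ₃} {_⊏_ : Rel C ℓ₄} (f : C → B) →
    (∀ {x y} → f x ≡ f y → x ≡ y) →
    (∀ {x y} → x ⊏ y → f x < f y) → (∀ {x y} → f x < f y → x ⊏ y) →
    IsStrictTotalOrder _≡_ _⊏_
  pullback-isStrictTotalOrder {_⊏_ = _⊏_} f f-injective to from = record
    { isStrictPartialOrder = record
      { isEquivalence = isEquivalence
      ; irrefl        = λ { refl x⊏x → irrefl refl (to x⊏x) }
      ; trans         = λ x⊏y y⊏z → from (<-trans (to x⊏y) (to y⊏z))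
      ; <-resp-≈      = resp₂ _⊏_
      }
    ; compare = compare′
    }
    where
    compare′ : ∀ x y → Tri (x ⊏ y) (x ≡ y) (y ⊏ x)
    compare′ x y with compare (f x) (f y)
    ... | tri< fx<fy fx≢fy fy≮fx = tri< (from fx<fy) (fx≢fy ∘ cong f) (fy≮fx ∘ to)
    ... | tri≈ fx≮fy fx≡fy fy≮fx = tri≈ (fx≮fy ∘ to) (f-injective fx≡fy) (fy≮fx ∘ to)
    ... | tri> fx≮fy fx≢fy fy<fx = tri> (fx≮fy ∘ to) (fx≢fy ∘ cong f) (from fy<fx)

  strictlyMonotone⇒reflecting : {C : Set ℓ₃} {_⊏_ : Rel C ℓ₄} → IsStrictPartialOrder _≡_ _⊏_ →
    (f : B → C) → (∀ {x y} → x < y → f x ⊏ f y) → ∀ {x y} → f x ⊏ f y → x < y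
  strictlyMonotone⇒reflecting ⊏-spo f mono {x} {y} fx⊏fy with compare x y
  ... | tri< x<y _ _ = x<y
  ... | tri≈ _ refl _ = ⊥-elim (IsStrictPartialOrder.irrefl ⊏-spo refl fx⊏fy)
  ... | tri> _ _ y<x = ⊥-elim (IsStrictPartialOrder.asym ⊏-spo fx⊏fy (mono y<x))

  Lex-isStrictTotalOrder : IsStrictTotalOrder _≡_ (Lex-< _≡_ _<_)
  Lex-isStrictTotalOrder = record
    { isStrictPartialOrder = record
      { isEquivalence = isEquivalence
      ; irrefl        = λ { refl → <-irreflexive irrefl (≡⇒Pointwise-≡ refl) }
      ; trans         = <-transitive isEquivalence (resp₂ _<_) <-trans
      ; <-resp-≈      = resp₂ _
      }
    ; compare = compare′
    }
    where
    compare′ : ∀ xs ys → Tri (Lex-< _≡_ _<_ xs ys) (xs ≡ ys) (Lex-< _≡_ _<_ ys xs)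
    compare′ xs ys with <-compare sym compare xs ys
    ... | tri< xs<ys xs≢ys ys≮xs = tri< xs<ys (xs≢ys ∘ ≡⇒Pointwise-≡) ys≮xs
    ... | tri≈ xs≮ys xs≡ys ys≮xs = tri≈ xs≮ys (Pointwise-≡⇒≡ xs≡ys) ys≮xs
    ... | tri> xs≮ys xs≢ys ys<xs = tri> xs≮ys (xs≢ys ∘ ≡⇒Pointwise-≡) ys<xs

length-∷ʳ : ∀ {B : Set ℓ₁} (xs : List B) x → length (xs ∷ʳ x) ≡ suc (length xs)
length-∷ʳ xs x = trans (length-++ xs) (ℕ.+-comm (length xs) 1)

0<length-∷ʳ : ∀ {B : Set ℓ₁} (xs : List B) x → 0 <ℕ length (xs ∷ʳ x)
0<length-∷ʳ xs x = subst (0 <ℕ_) (sym (length-∷ʳ xs x)) (s≤s z≤n)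

length-∷ʳ-< : ∀ {B : Set ℓ₁} (xs ys : List B) {x y} →
  length xs <ℕ length ys → length (xs ∷ʳ x) <ℕ length (ys ∷ʳ y)
length-∷ʳ-< xs ys {x} {y} |xs|<|ys| = subst₂ _<ℕ_ (sym (length-∷ʳ xs x)) (sym (length-∷ʳ ys y)) (s≤s |xs|<|ys|)

reverse-∷ʳ : ∀ {B : Set ℓ₁} (xs : List B) x → reverse (xs ∷ʳ x) ≡ x ∷ reverse xs
reverse-∷ʳ xs x = reverse-++ xs [ x ]

reverse-++-∷ : ∀ {B : Set ℓ₁} (xs : List B) x ys → reverse (xs ++ x ∷ ys) ≡ reverse ys ++ x ∷ reverse xs
reverse-++-∷ xs x ys = trans (reverse-++ xs (x ∷ ys))
  (trans (cong (_++ reverse xs) (unfold-reverse x ys)) (++-assoc (reverse ys) [ x ] (reverse xs)))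

module _ {B : Set ℓ₁} {R : Rel B ℓ₂} where
  private
    _<ˡ_ : Rel (List B) (ℓ₁ ⊔ ℓ₂)
    _<ˡ_ = Lex-< _≡_ R

  ++⁺ˡ-Lex : ∀ zs {xs ys} → xs <ˡ ys → (zs ++ xs) <ˡ (zs ++ ys)
  ++⁺ˡ-Lex []       xs<ys = xs<ys
  ++⁺ˡ-Lex (z ∷ zs) xs<ys = next refl (++⁺ˡ-Lex zs xs<ys)

  ++⁺ʳ-Lex : ∀ {xs ys} us vs → length xs ≡ length ys → xs <ˡ ys → (xs ++ us) <ˡ (ys ++ vs)
  ++⁺ʳ-Lex us vs ()  halt
  ++⁺ʳ-Lex us vs _   (this x<y)        = this x<y
  ++⁺ʳ-Lex us vs |≡| (next refl xs<ys) = next refl (++⁺ʳ-Lex us vs (cong pred |≡|) xs<ys)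

  Lex-extendʳ : ∀ {xs ys} vs → xs <ˡ ys → xs <ˡ (ys ++ vs)
  Lex-extendʳ vs halt              = halt
  Lex-extendʳ vs (this x<y)        = this x<y
  Lex-extendʳ vs (next refl xs<ys) = next refl (Lex-extendʳ vs xs<ys)

  Lex-extendˡ : ∀ {xs ys} us → length ys ≤ length xs → xs <ˡ ys → (xs ++ us) <ˡ ys
  Lex-extendˡ us ()       halt
  Lex-extendˡ us _        (this x<y)        = this x<y
  Lex-extendˡ us (s≤s le) (next refl xs<ys) = next refl (Lex-extendˡ us le xs<ys)

  Lex-properPrefix : ∀ xs {y ys} → xs <ˡ (xs ++ y ∷ ys)
  Lex-properPrefix []       = halt
  Lex-properPrefix (x ∷ xs) = next refl (Lex-properPrefix xs)

  Lex-split : ∀ {xs ys} → xs <ˡ ys →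
    (∃[ y ] ∃[ zs ] ys ≡ xs ++ y ∷ zs) ⊎
    (∃[ ps ] ∃[ x ] ∃[ y ] ∃[ us ] ∃[ vs ] (xs ≡ ps ++ x ∷ us × ys ≡ ps ++ y ∷ vs × R x y))
  Lex-split (halt {y} {zs}) = inj₁ (y , zs , refl)
  Lex-split (this {x} {xs} {y} {ys} x<y) = inj₂ ([] , x , y , xs , ys , refl , refl , x<y)
  Lex-split (next {z} refl xs<ys) with Lex-split xs<ys
  ... | inj₁ (y , zs , refl) = inj₁ (y , zs , refl)
  ... | inj₂ (ps , x , y , us , vs , refl , refl , x<y) = inj₂ (z ∷ ps , x , y , us , vs , refl , refl , x<y)

  Lex-∷ʳ⁻ʳ : ∀ xs ys {y} → length xs ≤ length ys → xs <ˡ (ys ∷ʳ y) → xs ≡ ys ⊎ xs <ˡ ys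
  Lex-∷ʳ⁻ʳ []       []       _        _                 = inj₁ refl
  Lex-∷ʳ⁻ʳ []       (_ ∷ _)  _        _                 = inj₂ halt
  Lex-∷ʳ⁻ʳ (_ ∷ xs) (_ ∷ ys) _        (this x<y)        = inj₂ (this x<y)
  Lex-∷ʳ⁻ʳ (_ ∷ xs) (_ ∷ ys) (s≤s le) (next refl xs<ys) with Lex-∷ʳ⁻ʳ xs ys le xs<ys
  ... | inj₁ refl   = inj₁ refl
  ... | inj₂ xs<ys′ = inj₂ (next refl xs<ys′)

  Lex-∷ʳ⁻ˡ : ∀ xs ys {x} → length ys ≤ length xs → (xs ∷ʳ x) <ˡ ys → xs <ˡ ys
  Lex-∷ʳ⁻ˡ []       []       _        ()
  Lex-∷ʳ⁻ˡ (_ ∷ xs) (_ ∷ ys) _        (this x<y)        = this x<y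
  Lex-∷ʳ⁻ˡ (_ ∷ xs) (_ ∷ ys) (s≤s le) (next refl xs<ys) = next refl (Lex-∷ʳ⁻ˡ xs ys le xs<ys)

  Lex-∷ʳ⁻ : ∀ xs ys {x y} → length xs ≡ length ys →
    (xs ∷ʳ x) <ˡ (ys ∷ʳ y) → xs <ˡ ys ⊎ (xs ≡ ys × R x y)
  Lex-∷ʳ⁻ []       []       _   (this x<y)        = inj₂ (refl , x<y)
  Lex-∷ʳ⁻ []       []       _   (next refl (base ()))
  Lex-∷ʳ⁻ (_ ∷ xs) (_ ∷ ys) _   (this x<y)        = inj₁ (this x<y)
  Lex-∷ʳ⁻ (_ ∷ xs) (_ ∷ ys) |≡| (next refl xs<ys) with Lex-∷ʳ⁻ xs ys (cong pred |≡|) xs<ys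
  ... | inj₁ xs<ys′       = inj₁ (next refl xs<ys′)
  ... | inj₂ (refl , x<y) = inj₂ (refl , x<y)

  Lex-firstDifference : ∀ {xs ys} → length xs ≡ length ys → xs <ˡ ys →
    ∃[ zs ] ∃[ x ] ∃[ y ] ∃[ us ] ∃[ vs ]
      (xs ≡ zs ++ x ∷ us × ys ≡ zs ++ y ∷ vs × R x y × length us ≡ length vs)
  Lex-firstDifference () halt
  Lex-firstDifference |≡| (this {x} {xs} {y} {ys} x<y) = [] , x , y , xs , ys , refl , refl , x<y , cong pred |≡|
  Lex-firstDifference |≡| (next {z} refl xs<ys) with Lex-firstDifference (cong pred |≡|) xs<ys
  ... | zs , x , y , us , vs , refl , refl , x<y , |us|≡|vs| = z ∷ zs , x , y , us , vs , refl , refl , x<y , |us|≡|vs|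

module VOrderProperties {a ℓ} {A : Set a} {_<_ : Rel A ℓ} (sto : IsStrictTotalOrder _≡_ _<_) where
  open VOrder sto
  open IsStrictTotalOrder sto using (compare) renaming (trans to <-trans)

  leq-false⇒> : ∀ {x y} → leq x y ≡ false → y < x
  leq-false⇒> {x} {y} _ with compare x y
  ... | tri> _ _ y<x = y<x

  leq-true⇒≤ : ∀ {x y} → leq x y ≡ true → x < y ⊎ x ≡ y
  leq-true⇒≤ {x} {y} _ with compare x y
  ... | tri< x<y _ _ = inj₁ x<y
  ... | tri≈ _ x≡y _ = inj₂ x≡y

  <⇒leq-true : ∀ {x y} → x < y → leq x y ≡ true
  <⇒leq-true {x} {y} x<y with compare x y
  ... | tri< _ _ _   = refl
  ... | tri≈ _ _ _   = refl
  ... | tri> x≮y _ _ = ⊥-elim (x≮y x<y)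

  >⇒leq-false : ∀ {x y} → y < x → leq x y ≡ false
  >⇒leq-false {x} {y} y<x with compare x y
  ... | tri< _ _ y≮x = ⊥-elim (y≮x y<x)
  ... | tri≈ _ _ y≮x = ⊥-elim (y≮x y<x)
  ... | tri> _ _ _   = refl

  <-leq-trans : ∀ {x y z} → x < y → leq y z ≡ true → leq x z ≡ true
  <-leq-trans x<y y≤z with leq-true⇒≤ y≤z
  ... | inj₁ y<z  = <⇒leq-true (<-trans x<y y<z)
  ... | inj₂ refl = <⇒leq-true x<y

  -- Star at the front and at the back of a string

  length-star-∷ : ∀ c x → length (star (c ∷ x)) ≡ length x
  length-star-∷ c []      = refl
  length-star-∷ c (d ∷ x) with nondec (c ∷ d ∷ x)
  ... | true  = refl
  ... | false = cong suc (length-star-∷ d x)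

  length-star : ∀ x → length (star x) ≡ pred (length x)
  length-star []      = refl
  length-star (c ∷ x) = length-star-∷ c x

  suc-length-star : ∀ x → 0 <ℕ length x → suc (length (star x)) ≡ length x
  suc-length-star (c ∷ x) _ = cong suc (length-star-∷ c x)

  star-shorter : ∀ x → 0 <ℕ length x → length (star x) <ℕ length x
  star-shorter (c ∷ x) _ rewrite length-star (c ∷ x) = ℕ.≤-refl

  data StarView (c : A) (x : List A) : Set a where
    headDeleted : nondec (c ∷ x) ≡ true  → star (c ∷ x) ≡ x          → StarView c x
    headKept    : nondec (c ∷ x) ≡ false → star (c ∷ x) ≡ c ∷ star x → StarView c x

  star-∷-view : ∀ c x → StarView c x
  star-∷-view c x with nondec (c ∷ x) in nd
  ... | true  = headDeleted nd (cong (if_then x else c ∷ star x) nd)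
  ... | false = headKept nd (cong (if_then x else c ∷ star x) nd)

  nondec-∷⁻ : ∀ {c d x} → nondec (c ∷ d ∷ x) ≡ true → leq c d ≡ true × nondec (d ∷ x) ≡ true
  nondec-∷⁻ {c} {d} nd with leq c d
  ... | true = refl , nd

  ¬nondec-∷⁻ : ∀ {c d} x → nondec (c ∷ d ∷ x) ≡ false → nondec (d ∷ x) ≡ true → d < c
  ¬nondec-∷⁻ {c} {d} x nd nd′ with leq c d in c≤d
  ... | false = leq-false⇒> c≤d
  ... | true  with () ← trans (sym nd′) nd

  nondec-lowerHead : ∀ {c d} x → c < d → nondec (d ∷ x) ≡ true → nondec (c ∷ x) ≡ true
  nondec-lowerHead []      c<d _  = refl
  nondec-lowerHead (e ∷ x) c<d nd with nondec-∷⁻ {x = x} nd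
  ... | d≤e , nd′ rewrite <-leq-trans c<d d≤e = nd′

  endsAbove : List A → A → Bool
  endsAbove []          e = true
  endsAbove (c ∷ [])    e = not (leq c e)
  endsAbove (c ∷ d ∷ w) e = endsAbove (d ∷ w) e

  endsAbove-∷ʳ : ∀ w c e → endsAbove (w ∷ʳ c) e ≡ not (leq c e)
  endsAbove-∷ʳ []          c e = refl
  endsAbove-∷ʳ (d ∷ [])    c e = refl
  endsAbove-∷ʳ (d ∷ f ∷ w) c e = endsAbove-∷ʳ (f ∷ w) c e

  endsAbove-mono : ∀ w {d e} → endsAbove w d ≡ true → e < d → endsAbove w e ≡ true
  endsAbove-mono []          _   _   = refl
  endsAbove-mono (c ∷ [])    {d} w>d e<d with leq c d in c≤d
  endsAbove-mono (c ∷ [])    {d} refl e<d | false rewrite >⇒leq-false (<-trans e<d (leq-false⇒> c≤d)) = refl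
  endsAbove-mono (c ∷ f ∷ w) w>d e<d = endsAbove-mono (f ∷ w) w>d e<d

  nondec-∷ʳ : ∀ c w e → nondec ((c ∷ w) ∷ʳ e) ≡ nondec (c ∷ w) ∧ not (endsAbove (c ∷ w) e)
  nondec-∷ʳ c []      e with leq c e
  ... | true  = refl
  ... | false = refl
  nondec-∷ʳ c (d ∷ w) e with leq c d
  ... | true  = nondec-∷ʳ d w e
  ... | false = refl

  star-∷ʳ-endsAbove : ∀ w {e} → endsAbove w e ≡ true → star (w ∷ʳ e) ≡ w
  star-∷ʳ-endsAbove []      _ = refl
  star-∷ʳ-endsAbove (c ∷ w) {e} w>e
    rewrite nondec-∷ʳ c w e | w>e | ∧-zeroʳ (nondec (c ∷ w)) = cong (c ∷_) (tail w w>e)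
    where
    tail : ∀ w → endsAbove (c ∷ w) e ≡ true → star (w ∷ʳ e) ≡ w
    tail []      _   = refl
    tail (d ∷ w) w>e = star-∷ʳ-endsAbove (d ∷ w) w>e

  star-∷ʳ-¬endsAbove : ∀ w {e} → endsAbove w e ≡ false → star (w ∷ʳ e) ≡ star w ∷ʳ e
  star-∷ʳ-¬endsAbove (c ∷ w) {e} w≯e rewrite nondec-∷ʳ c w e | w≯e | ∧-identityʳ (nondec (c ∷ w))
    with nondec (c ∷ w) in nd
  ... | true = refl
  star-∷ʳ-¬endsAbove (c ∷ d ∷ w) w≯e | false = cong (c ∷_) (star-∷ʳ-¬endsAbove (d ∷ w) w≯e)

  data StarSnocView (w : List A) (e : A) : Set a where
    lastDeleted : endsAbove w e ≡ true  → star (w ∷ʳ e) ≡ w          → StarSnocView w e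
    lastKept    : endsAbove w e ≡ false → star (w ∷ʳ e) ≡ star w ∷ʳ e → StarSnocView w e

  star-∷ʳ-view : ∀ w e → StarSnocView w e
  star-∷ʳ-view w e with endsAbove w e in w>e
  ... | true  = lastDeleted w>e (star-∷ʳ-endsAbove w w>e)
  ... | false = lastKept w>e (star-∷ʳ-¬endsAbove w w>e)

  endsAbove-∷ʳ-false⇒leq : ∀ w {c e} → endsAbove (w ∷ʳ c) e ≡ false → leq c e ≡ true
  endsAbove-∷ʳ-false⇒leq w {c} {e} w≯e = not-injective (trans (sym (endsAbove-∷ʳ w c e)) w≯e)

  endsAbove-∷ʳ-true⇒> : ∀ w {c e} → endsAbove (w ∷ʳ c) e ≡ true → e < c
  endsAbove-∷ʳ-true⇒> w {c} {e} w>e = leq-false⇒> (not-injective (trans (sym (endsAbove-∷ʳ w c e)) w>e))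

  endsAbove-nonEmpty : ∀ w {e} → endsAbove w e ≡ false → 0 <ℕ length w
  endsAbove-nonEmpty (_ ∷ _) _ = s≤s z≤n

  -- The colexicographic order

  infix 4 _<ᶜ_ _⊏_ _⊑_ _⊏ˢ_

  record _<ᶜ_ (u v : List A) : Set (a ⊔ ℓ) where
    constructor colex
    field lex : Lex-< _≡_ _<_ (reverse u) (reverse v)

  <ᶜ-isStrictTotalOrder : IsStrictTotalOrder _≡_ _<ᶜ_
  <ᶜ-isStrictTotalOrder =
    pullback-isStrictTotalOrder (Lex-isStrictTotalOrder sto) reverse reverse-injective _<ᶜ_.lex colex

  open IsStrictTotalOrder <ᶜ-isStrictTotalOrder using () renaming (irrefl to <ᶜ-irrefl)

  <ᶜ-byReverse : ∀ {u v u′ v′} → reverse u ≡ u′ → reverse v ≡ v′ → Lex-< _≡_ _<_ u′ v′ → u <ᶜ v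
  <ᶜ-byReverse ru≡ rv≡ = colex ∘ subst₂ (Lex-< _≡_ _<_) (sym ru≡) (sym rv≡)

  <ᶜ-lastLetter : ∀ u v {x y} → x < y → (u ∷ʳ x) <ᶜ (v ∷ʳ y)
  <ᶜ-lastLetter u v {x} {y} x<y = <ᶜ-byReverse (reverse-∷ʳ u x) (reverse-∷ʳ v y) (this x<y)

  ∷ʳ⁺-<ᶜ : ∀ {u v} x → u <ᶜ v → (u ∷ʳ x) <ᶜ (v ∷ʳ x)
  ∷ʳ⁺-<ᶜ {u} {v} x (colex u<v) = <ᶜ-byReverse (reverse-∷ʳ u x) (reverse-∷ʳ v x) (next refl u<v)

  <ᶜ-firstLetter : ∀ z {x y} → x < y → (x ∷ z) <ᶜ (y ∷ z)
  <ᶜ-firstLetter z {x} {y} x<y =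
    <ᶜ-byReverse (unfold-reverse x z) (unfold-reverse y z) (++⁺ˡ-Lex (reverse z) (this x<y))

  ∷⁺-<ᶜ : ∀ {u v} x y → length u ≡ length v → u <ᶜ v → (x ∷ u) <ᶜ (y ∷ v)
  ∷⁺-<ᶜ {u} {v} x y |u|≡|v| (colex u<v) = <ᶜ-byReverse (unfold-reverse x u) (unfold-reverse y v)
    (++⁺ʳ-Lex [ x ] [ y ] (trans (length-reverse u) (trans |u|≡|v| (sym (length-reverse v)))) u<v)

  LastDiffLess⇒<ᶜ : ∀ {u v} → LastDiffLess u v → u <ᶜ v × length u ≡ length v
  LastDiffLess⇒<ᶜ (p , q , c , d , w , refl , refl , |p|≡|q| , c<d) =
    <ᶜ-byReverse (reverse-++-∷ p c w) (reverse-++-∷ q d w) (++⁺ˡ-Lex (reverse w) (this c<d)) ,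
    trans (length-++ p) (trans (cong (_+ suc (length w)) |p|≡|q|) (sym (length-++ q)))

  <ᶜ⇒LastDiffLess : ∀ {u v} → length u ≡ length v → u <ᶜ v → LastDiffLess u v
  <ᶜ⇒LastDiffLess {u} {v} |u|≡|v| (colex u<v)
    with Lex-firstDifference (trans (length-reverse u) (trans |u|≡|v| (sym (length-reverse v)))) u<v
  ... | w , c , d , p , q , ru≡ , rv≡ , c<d , |p|≡|q| =
    reverse p , reverse q , c , d , reverse w , unreverse u ru≡ , unreverse v rv≡ ,
    trans (length-reverse p) (trans |p|≡|q| (sym (length-reverse q))) , c<d
    where
    unreverse : ∀ z {e p} → reverse z ≡ w ++ e ∷ p → z ≡ reverse p ++ e ∷ reverse w
    unreverse z {e} {p} rz≡ = reverse-injective (trans rz≡ (sym (begin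
      reverse (reverse p ++ e ∷ reverse w)           ≡⟨ reverse-++-∷ (reverse p) e (reverse w) ⟩
      reverse (reverse w) ++ e ∷ reverse (reverse p) ≡⟨ cong₂ (λ w′ p′ → w′ ++ e ∷ p′)
                                                           (reverse-involutive w) (reverse-involutive p) ⟩
      w ++ e ∷ p                                     ∎)))
      where open ≡-Reasoning

  -- The chain order

  chainN : ℕ → List A → List (List A)
  chainN zero    x = []
  chainN (suc n) x = chainN n (star x) ∷ʳ x

  chain : List A → List (List A)
  chain x = chainN (length x) x

  length-chainN : ∀ n x → length (chainN n x) ≡ n
  length-chainN zero    x = refl
  length-chainN (suc n) x = trans (length-∷ʳ (chainN n (star x)) x) (cong suc (length-chainN n (star x)))

  length-chain : ∀ x → length (chain x) ≡ length x
  length-chain x = length-chainN (length x) x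

  chain-star : ∀ x → 0 <ℕ length x → chain x ≡ chain (star x) ∷ʳ x
  chain-star (c ∷ x) _ rewrite length-star-∷ c x = refl

  chain-injective : ∀ {x y} → chain x ≡ chain y → x ≡ y
  chain-injective {[]}    {[]}    _  = refl
  chain-injective {[]}    {d ∷ y} eq with () ← trans (cong length eq) (length-chain (d ∷ y))
  chain-injective {c ∷ x} {[]}    eq with () ← trans (sym (length-chain (c ∷ x))) (cong length eq)
  chain-injective {c ∷ x} {d ∷ y} eq =
    proj₂ (∷ʳ-injective (chain (star (c ∷ x))) (chain (star (d ∷ y)))
      (trans (sym (chain-star _ (s≤s z≤n))) (trans eq (chain-star _ (s≤s z≤n)))))

  record _⊏_ (x y : List A) : Set (a ⊔ ℓ) where
    constructor chainLex
    field lex : Lex-< _≡_ _<ᶜ_ (chain x) (chain y)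

  ⊏-isStrictTotalOrder : IsStrictTotalOrder _≡_ _⊏_
  ⊏-isStrictTotalOrder =
    pullback-isStrictTotalOrder (Lex-isStrictTotalOrder <ᶜ-isStrictTotalOrder) chain chain-injective _⊏_.lex chainLex

  open IsStrictTotalOrder ⊏-isStrictTotalOrder
    using () renaming (irrefl to ⊏-irrefl; trans to ⊏-trans)

  _⊑_ : Rel (List A) (a ⊔ ℓ)
  _⊑_ = NonStrict._≤_ _≡_ _⊏_

  ⊑-trans : ∀ {x y z} → x ⊑ y → y ⊑ z → x ⊑ z
  ⊑-trans = NonStrict.trans _≡_ _⊏_ isEquivalence (resp₂ _⊏_) ⊏-trans

  ⊏-⊑-trans : ∀ {x y z} → x ⊏ y → y ⊑ z → x ⊏ z
  ⊏-⊑-trans = NonStrict.<-≤-trans _≡_ _⊏_ ⊏-trans (proj₁ (resp₂ _⊏_))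

  ⊑-⊏-trans : ∀ {x y z} → x ⊑ y → y ⊏ z → x ⊏ z
  ⊑-⊏-trans = NonStrict.≤-<-trans _≡_ _⊏_ sym ⊏-trans (proj₂ (resp₂ _⊏_))

  private
    Lexᶜ : Rel (List (List A)) (a ⊔ ℓ)
    Lexᶜ = Lex-< _≡_ _<ᶜ_

    length-chain-star : ∀ x y → length x ≡ length y → length (chain (star x)) ≡ length (chain (star y))
    length-chain-star x y |x|≡|y| = begin
      length (chain (star x)) ≡⟨ length-chain (star x) ⟩
      length (star x)         ≡⟨ length-star x ⟩
      pred (length x)         ≡⟨ cong pred |x|≡|y| ⟩
      pred (length y)         ≡⟨ length-star y ⟨
      length (star y)         ≡⟨ length-chain (star y) ⟨
      length (chain (star y)) ∎
      where open ≡-Reasoning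

    length-chain-star≤ : ∀ x y → length x <ℕ length y → length (chain x) ≤ length (chain (star y))
    length-chain-star≤ x y |x|<|y|
      rewrite length-chain x | length-chain (star y) | length-star y = ℕ.pred-mono-≤ |x|<|y|

  _⊏ˢ_ : Rel (List A) (a ⊔ ℓ)
  x ⊏ˢ y = star x ⊏ star y ⊎ (star x ≡ star y × x <ᶜ y)

  ⊏-sameLength⁺ : ∀ {x y} → 0 <ℕ length x → length x ≡ length y → x ⊏ˢ y → x ⊏ y
  ⊏-sameLength⁺ {x} {y} 0<|x| |x|≡|y| x⊏ˢy =
    chainLex (subst₂ Lexᶜ (sym (chain-star x 0<|x|)) (sym (chain-star y (subst (0 <ℕ_) |x|≡|y| 0<|x|))) (lex x⊏ˢy))
    where
    lex : x ⊏ˢ y → Lexᶜ (chain (star x) ∷ʳ x) (chain (star y) ∷ʳ y)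
    lex (inj₁ (chainLex x*⊏y*))  = ++⁺ʳ-Lex [ x ] [ y ] (length-chain-star x y |x|≡|y|) x*⊏y*
    lex (inj₂ (x*≡y* , x<ᶜy)) rewrite x*≡y* = ++⁺ˡ-Lex (chain (star y)) (this x<ᶜy)

  ⊏-sameLength⁻ : ∀ {x y} → 0 <ℕ length x → length x ≡ length y → x ⊏ y → x ⊏ˢ y
  ⊏-sameLength⁻ {x} {y} 0<|x| |x|≡|y| (chainLex x⊏y)
    with Lex-∷ʳ⁻ (chain (star x)) (chain (star y)) (length-chain-star x y |x|≡|y|)
           (subst₂ Lexᶜ (chain-star x 0<|x|) (chain-star y (subst (0 <ℕ_) |x|≡|y| 0<|x|)) x⊏y)
  ... | inj₁ x*⊏y*           = inj₁ (chainLex x*⊏y*)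
  ... | inj₂ (x*≡y* , x<ᶜy) = inj₂ (chain-injective x*≡y* , x<ᶜy)

  ⊏-shorter⁺ : ∀ {x y} → length x <ℕ length y → x ⊑ star y → x ⊏ y
  ⊏-shorter⁺ {x} {y} |x|<|y| x⊑y* =
    chainLex (subst (Lexᶜ (chain x)) (sym (chain-star y (ℕ.m<n⇒0<n |x|<|y|))) (lex x⊑y*))
    where
    lex : x ⊑ star y → Lexᶜ (chain x) (chain (star y) ∷ʳ y)
    lex (inj₁ (chainLex x⊏y*)) = Lex-extendʳ [ y ] x⊏y*
    lex (inj₂ refl)            = Lex-properPrefix (chain x)

  ⊏-shorter⁻ : ∀ {x y} → length x <ℕ length y → x ⊏ y → x ⊑ star y
  ⊏-shorter⁻ {x} {y} |x|<|y| (chainLex x⊏y)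
    with Lex-∷ʳ⁻ʳ (chain x) (chain (star y)) (length-chain-star≤ x y |x|<|y|)
           (subst (Lexᶜ (chain x)) (chain-star y (ℕ.m<n⇒0<n |x|<|y|)) x⊏y)
  ... | inj₁ x≡y*  = inj₂ (chain-injective x≡y*)
  ... | inj₂ x⊏y* = inj₁ (chainLex x⊏y*)

  ⊏-longer⁺ : ∀ {x y} → length y <ℕ length x → star x ⊏ y → x ⊏ y
  ⊏-longer⁺ {x} {y} |y|<|x| (chainLex x*⊏y) =
    chainLex (subst (λ cx → Lexᶜ cx (chain y)) (sym (chain-star x (ℕ.m<n⇒0<n |y|<|x|)))
      (Lex-extendˡ [ x ] (length-chain-star≤ y x |y|<|x|) x*⊏y))

  ⊏-longer⁻ : ∀ {x y} → length y <ℕ length x → x ⊏ y → star x ⊏ y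
  ⊏-longer⁻ {x} {y} |y|<|x| (chainLex x⊏y) =
    chainLex (Lex-∷ʳ⁻ˡ (chain (star x)) (chain y) (length-chain-star≤ y x |y|<|x|)
      (subst (λ cx → Lexᶜ cx (chain y)) (chain-star x (ℕ.m<n⇒0<n |y|<|x|)) x⊏y))

  -- Adding a letter on either side preserves the chain order

  tail-<ᶜ-∷star : ∀ {b} y → nondec (b ∷ y) ≡ false → y <ᶜ b ∷ star y
  tail-<ᶜ-∷star {b} (c ∷ y) nd with star-∷-view c y
  ... | headDeleted nd′ y*≡ =
    subst (λ z → c ∷ y <ᶜ b ∷ z) (sym y*≡) (<ᶜ-firstLetter y (¬nondec-∷⁻ y nd nd′))
  tail-<ᶜ-∷star {b} (c ∷ d ∷ y) nd | headKept nd′ y*≡ =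
    subst (λ z → c ∷ d ∷ y <ᶜ b ∷ z) (sym y*≡)
      (∷⁺-<ᶜ c b (cong suc (sym (length-star-∷ d y))) (tail-<ᶜ-∷star (d ∷ y) nd′))

  tail-⊏-∷star : ∀ {b} y → nondec (b ∷ y) ≡ false → y ⊏ b ∷ star y
  tail-⊏-∷star y = bounded (length y) y ℕ.≤-refl
    where
    bounded : ∀ n {b} y → length y ≤ n → nondec (b ∷ y) ≡ false → y ⊏ b ∷ star y
    bounded (suc n) {b} (c ∷ y) (s≤s |y|≤n) nd =
      ⊏-sameLength⁺ (s≤s z≤n) (cong suc (sym (length-star-∷ c y))) step
      where
      y′ = star (c ∷ y)
      step : c ∷ y ⊏ˢ b ∷ y′
      step with star-∷-view b y′
      ... | headDeleted _ by′*≡ = inj₂ (sym by′*≡ , tail-<ᶜ-∷star (c ∷ y) nd)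
      ... | headKept nd′ by′*≡  = inj₁ (subst (y′ ⊏_) (sym by′*≡)
                                     (bounded n y′ (subst (_≤ n) (sym (length-star-∷ c y)) |y|≤n) nd′))

  tail-⊏ : ∀ b y → y ⊏ b ∷ y
  tail-⊏ b y = ⊏-shorter⁺ ℕ.≤-refl y⊑star
    where
    y⊑star : y ⊑ star (b ∷ y)
    y⊑star with star-∷-view b y
    ... | headDeleted _ by*≡ = inj₂ (sym by*≡)
    ... | headKept nd by*≡   = inj₁ (subst (y ⊏_) (sym by*≡) (tail-⊏-∷star y nd))

  ⊏-firstLetter : ∀ {c d} z → c < d → c ∷ z ⊏ d ∷ z
  ⊏-firstLetter z = bounded (length z) z ℕ.≤-refl
    where
    bounded : ∀ n {c d} z → length z ≤ n → c < d → c ∷ z ⊏ d ∷ z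
    bounded n {c} {d} z |z|≤n c<d = ⊏-sameLength⁺ (s≤s z≤n) refl (step n z |z|≤n)
      where
      step : ∀ n z → length z ≤ n → c ∷ z ⊏ˢ d ∷ z
      step n z |z|≤n with star-∷-view c z | star-∷-view d z
      ... | headDeleted _ cz*≡ | headDeleted _ dz*≡ = inj₂ (trans cz*≡ (sym dz*≡) , <ᶜ-firstLetter z c<d)
      ... | headDeleted _ cz*≡ | headKept ndd dz*≡  =
        inj₁ (subst₂ _⊏_ (sym cz*≡) (sym dz*≡) (tail-⊏-∷star z ndd))
      ... | headKept ndc _     | headDeleted ndd _  with () ← trans (sym ndc) (nondec-lowerHead z c<d ndd)
      step (suc n) (e ∷ z) (s≤s |z|≤n) | headKept _ cz*≡ | headKept _ dz*≡ =
        inj₁ (subst₂ _⊏_ (sym cz*≡) (sym dz*≡)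
          (bounded n (star (e ∷ z)) (subst (_≤ n) (sym (length-star-∷ e z)) |z|≤n) c<d))

  length-star-∷ʳ : ∀ w e → length (star (w ∷ʳ e)) ≡ length w
  length-star-∷ʳ w e = trans (length-star (w ∷ʳ e)) (cong pred (length-∷ʳ w e))

  endsAbove-star-∷ʳ : ∀ w {e b} → b < e → endsAbove (star (w ∷ʳ e)) b ≡ true
  endsAbove-star-∷ʳ w {e} {b} b<e with star-∷ʳ-view w e
  ... | lastDeleted w>e w*≡ = subst (λ z → endsAbove z b ≡ true) (sym w*≡) (endsAbove-mono w w>e b<e)
  ... | lastKept _ w*≡      = subst (λ z → endsAbove z b ≡ true) (sym w*≡)
                                (trans (endsAbove-∷ʳ (star w) e b) (cong not (>⇒leq-false b<e)))

  star∷ʳ-⊏ : ∀ y {b} → 0 <ℕ length y → endsAbove y b ≡ true → star y ∷ʳ b ⊏ y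
  star∷ʳ-⊏ y {b} 0<|y| y>b with initLast y
  star∷ʳ-⊏ .[] () _ | []
  star∷ʳ-⊏ .(w ∷ʳ e) {b} _ y>b | w ∷ʳ′ e = ⊏-sameLength⁺ (0<length-∷ʳ S b) |S∷ʳb|≡|w∷ʳe|
                    (inj₂ (star-∷ʳ-endsAbove S (endsAbove-star-∷ʳ w b<e) , <ᶜ-lastLetter S w b<e))
    where
    S = star (w ∷ʳ e)
    b<e = endsAbove-∷ʳ-true⇒> w y>b
    |S∷ʳb|≡|w∷ʳe| : length (S ∷ʳ b) ≡ length (w ∷ʳ e)
    |S∷ʳb|≡|w∷ʳe| = trans (length-∷ʳ S b) (trans (cong suc (length-star-∷ʳ w e)) (sym (length-∷ʳ w e)))

  private
    ⊑-star∷ʳ-bounded : ∀ n y {b} → length y ≤ n → endsAbove y b ≡ false → y ⊑ star y ∷ʳ b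
    ⊏-lastLetter-bounded : ∀ n w {e b} → length w <ℕ n → e < b → w ∷ʳ e ⊏ w ∷ʳ b

    ⊑-star∷ʳ-bounded n y {b} |y|≤n y≯b with initLast y
    ⊑-star∷ʳ-bounded n .(w ∷ʳ e) {b} |y|≤n y≯b | w ∷ʳ′ e with star-∷ʳ-view w e
    ... | lastDeleted _ w*≡ = subst (λ z → w ∷ʳ e ⊑ z ∷ʳ b) (sym w*≡) lastLetter
      where
      lastLetter : w ∷ʳ e ⊑ w ∷ʳ b
      lastLetter with leq-true⇒≤ (endsAbove-∷ʳ-false⇒leq w y≯b)
      ... | inj₁ e<b  = inj₁ (⊏-lastLetter-bounded n w (subst (_≤ n) (length-∷ʳ w e) |y|≤n) e<b)
      ... | inj₂ refl = inj₂ refl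
    ⊑-star∷ʳ-bounded zero .(w ∷ʳ e) |y|≤0 _ | w ∷ʳ′ e | lastKept _ _
      with () ← subst (_≤ 0) (length-∷ʳ w e) |y|≤0
    ⊑-star∷ʳ-bounded (suc n) .(w ∷ʳ e) {b} |y|≤n y≯b | w ∷ʳ′ e | lastKept w≯e w*≡ =
      subst (λ z → w ∷ʳ e ⊑ z ∷ʳ b) (sym w*≡) kept
      where
      |w|≤n : length w ≤ n
      |w|≤n = ℕ.≤-pred (subst (_≤ suc n) (length-∷ʳ w e) |y|≤n)
      V = star w ∷ʳ e
      |V|≡|w| : length V ≡ length w
      |V|≡|w| = trans (length-∷ʳ (star w) e) (suc-length-star w (endsAbove-nonEmpty w w≯e))
      e≤b = endsAbove-∷ʳ-false⇒leq w y≯b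
      V≯b : endsAbove V b ≡ false
      V≯b = trans (endsAbove-∷ʳ (star w) e b) (cong not e≤b)
      V∷ʳb* : star (V ∷ʳ b) ≡ star V ∷ʳ b
      V∷ʳb* = star-∷ʳ-¬endsAbove V V≯b
      |w∷ʳe|≡|V∷ʳc| : ∀ {c} → length (w ∷ʳ e) ≡ length (V ∷ʳ c)
      |w∷ʳe|≡|V∷ʳc| {c} = trans (length-∷ʳ w e) (trans (cong suc (sym |V|≡|w|)) (sym (length-∷ʳ V c)))
      w∷ʳe⊏ : ∀ {c} → star (V ∷ʳ c) ≡ V → w ∷ʳ e <ᶜ V ∷ʳ c → w ∷ʳ e ⊏ V ∷ʳ c
      w∷ʳe⊏ V∷ʳc* w∷ʳe<ᶜ =
        ⊏-sameLength⁺ (0<length-∷ʳ w e) |w∷ʳe|≡|V∷ʳc| (inj₂ (trans w*≡ (sym V∷ʳc*) , w∷ʳe<ᶜ))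
      sameLast : e ≡ b → V ≡ star V ∷ʳ b → w ∷ʳ e ⊑ V ∷ʳ b
      sameLast refl V≡ with ⊑-star∷ʳ-bounded n w |w|≤n w≯e
      ... | inj₂ w≡V = inj₂ (cong (_∷ʳ e) w≡V)
      ... | inj₁ w⊏V with ⊏-sameLength⁻ (endsAbove-nonEmpty w w≯e) (sym |V|≡|w|) w⊏V
      ...   | inj₁ w*⊏V*       = ⊥-elim (⊏-irrefl (∷ʳ-injectiveˡ (star w) (star V) V≡) w*⊏V*)
      ...   | inj₂ (_ , w<ᶜV) = inj₁ (w∷ʳe⊏ (trans V∷ʳb* (sym V≡)) (∷ʳ⁺-<ᶜ e w<ᶜV))
      kept : w ∷ʳ e ⊑ V ∷ʳ b
      kept with ⊑-star∷ʳ-bounded n V (subst (_≤ n) (sym |V|≡|w|) |w|≤n) V≯b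
      ... | inj₁ V⊏ =
        inj₁ (⊏-sameLength⁺ (0<length-∷ʳ w e) |w∷ʳe|≡|V∷ʳc|
          (inj₁ (subst₂ _⊏_ (sym w*≡) (sym V∷ʳb*) V⊏)))
      ... | inj₂ V≡ with leq-true⇒≤ e≤b
      ...   | inj₁ e<b = inj₁ (w∷ʳe⊏ (trans V∷ʳb* (sym V≡)) (<ᶜ-lastLetter w V e<b))
      ...   | inj₂ e≡b = sameLast e≡b V≡

    ⊏-lastLetter-bounded (suc n) w {e} {b} (s≤s |w|≤n) e<b =
      ⊏-sameLength⁺ (0<length-∷ʳ w e) (trans (length-∷ʳ w e) (sym (length-∷ʳ w b))) step
      where
      step : w ∷ʳ e ⊏ˢ w ∷ʳ b
      step with star-∷ʳ-view w e | star-∷ʳ-view w b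
      ... | lastDeleted _ we* | lastDeleted _ wb* = inj₂ (trans we* (sym wb*) , <ᶜ-lastLetter w w e<b)
      ... | lastKept w≯e we*  | lastKept _ wb*    =
        inj₁ (subst₂ _⊏_ (sym we*) (sym wb*)
          (⊏-lastLetter-bounded n (star w)
            (subst (_≤ n) (sym (suc-length-star w (endsAbove-nonEmpty w w≯e))) |w|≤n) e<b))
      ... | lastDeleted _ we* | lastKept w≯b wb* with ⊑-star∷ʳ-bounded n w |w|≤n w≯b
      ...   | inj₁ w⊏ = inj₁ (subst₂ _⊏_ (sym we*) (sym wb*) w⊏)
      ...   | inj₂ w≡ = inj₂ (trans we* (trans w≡ (sym wb*)) , <ᶜ-lastLetter w w e<b)
      step | lastKept w≯e _ | lastDeleted w>b _ with () ← trans (sym (endsAbove-mono w w>b e<b)) w≯e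

  ⊑-star∷ʳ : ∀ y {b} → endsAbove y b ≡ false → y ⊑ star y ∷ʳ b
  ⊑-star∷ʳ y = ⊑-star∷ʳ-bounded (length y) y ℕ.≤-refl

  init-⊏ : ∀ y b → y ⊏ y ∷ʳ b
  init-⊏ y b = ⊏-shorter⁺ (subst (length y <ℕ_) (sym (length-∷ʳ y b)) ℕ.≤-refl) y⊑star
    where
    y⊑star : y ⊑ star (y ∷ʳ b)
    y⊑star with star-∷ʳ-view y b
    ... | lastDeleted _ yb* = inj₂ (sym yb*)
    ... | lastKept y≯b yb*  = subst (y ⊑_) (sym yb*) (⊑-star∷ʳ y y≯b)

  ⊏-sameLength-nonEmpty : ∀ {x y} → length x ≡ length y → x ⊏ y → 0 <ℕ length x
  ⊏-sameLength-nonEmpty {[]}    {[]} _ x⊏x = ⊥-elim (⊏-irrefl refl x⊏x)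
  ⊏-sameLength-nonEmpty {_ ∷ _}      _ _   = s≤s z≤n

  ⊑-firstLetter : ∀ {c d} z → leq c d ≡ true → c ∷ z ⊑ d ∷ z
  ⊑-firstLetter z c≤d with leq-true⇒≤ c≤d
  ... | inj₁ c<d  = inj₁ (⊏-firstLetter z c<d)
  ... | inj₂ refl = inj₂ refl

  ∷star-⊑ : ∀ a y → 0 <ℕ length y → nondec (a ∷ y) ≡ true → a ∷ star y ⊑ y
  ∷star-⊑ a (d ∷ y) _ nd with nondec-∷⁻ {x = y} nd
  ... | a≤d , nd′ =
    subst (λ z → a ∷ z ⊑ d ∷ y) (sym (cong (if_then y else d ∷ star y) nd′)) (⊑-firstLetter y a≤d)

  Preserves⊏Below : (List A → List A) → List A → List A → Set (a ⊔ ℓ)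
  Preserves⊏Below f x y =
    ∀ {x′ y′} → length x′ + length y′ <ℕ length x + length y → x′ ⊏ y′ → f x′ ⊏ f y′

  Preserves⊏Below-⊑ : ∀ {f} x y → Preserves⊏Below f x y →
    ∀ {x′ y′} → length x′ + length y′ <ℕ length x + length y → x′ ⊑ y′ → f x′ ⊑ f y′
  Preserves⊏Below-⊑ _ _ ih smaller (inj₁ x′⊏y′) = inj₁ (ih smaller x′⊏y′)
  Preserves⊏Below-⊑ _ _ ih smaller (inj₂ refl)   = inj₂ refl

  ⊏-preserved-bySizeInduction : ∀ f → (∀ {x y} → Preserves⊏Below f x y → x ⊏ y → f x ⊏ f y) →
    ∀ {x y} → x ⊏ y → f x ⊏ f y
  ⊏-preserved-bySizeInduction f step {x} {y} = bounded (suc (length x + length y)) ℕ.≤-refl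
    where
    bounded : ∀ n {x y} → length x + length y <ℕ n → x ⊏ y → f x ⊏ f y
    bounded (suc n) {x} {y} (s≤s bound) = step {x} {y} (λ smaller → bounded n (ℕ.<-≤-trans smaller bound))

  star-shorterˡ : ∀ (x y : List A) → 0 <ℕ length x → length (star x) + length y <ℕ length x + length y
  star-shorterˡ x y 0<|x| = ℕ.+-monoˡ-< (length y) (star-shorter x 0<|x|)

  star-shorterʳ : ∀ (x y : List A) → 0 <ℕ length y → length x + length (star y) <ℕ length x + length y
  star-shorterʳ x y 0<|y| = ℕ.+-monoʳ-< (length x) (star-shorter y 0<|y|)

  star-shorter² : ∀ x y → 0 <ℕ length x → 0 <ℕ length y →
    length (star x) + length (star y) <ℕ length x + length y
  star-shorter² x y 0<|x| 0<|y| = ℕ.+-mono-< (star-shorter x 0<|x|) (star-shorter y 0<|y|)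

  module _ (a : A) {x y : List A} (ih : Preserves⊏Below (a ∷_) x y) (x⊏y : x ⊏ y) where

    ∷⁺-⊏-shorter : length x <ℕ length y → x ⊑ star y → a ∷ x ⊑ star (a ∷ y)
    ∷⁺-⊏-shorter |x|<|y| x⊑y* with star-∷-view a y
    ... | headKept _ ay*≡     = subst (a ∷ x ⊑_) (sym ay*≡) (Preserves⊏Below-⊑ x y ih smaller x⊑y*)
      where smaller = star-shorterʳ x y (ℕ.m<n⇒0<n |x|<|y|)
    ... | headDeleted nd ay*≡ =
      subst (a ∷ x ⊑_) (sym ay*≡) (⊑-trans (Preserves⊏Below-⊑ x y ih smaller x⊑y*) (∷star-⊑ a y 0<|y| nd))
      where
      0<|y| = ℕ.m<n⇒0<n |x|<|y|
      smaller = star-shorterʳ x y 0<|y|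

    ∷⁺-⊏-sameLength : 0 <ℕ length x → 0 <ℕ length y → length x ≡ length y →
      x ⊏ˢ y → a ∷ x ⊏ˢ a ∷ y
    ∷⁺-⊏-sameLength 0<|x| 0<|y| |x|≡|y| x⊏ˢy with star-∷-view a x | star-∷-view a y
    ... | headDeleted _ ax*≡ | headDeleted _ ay*≡ = inj₁ (subst₂ _⊏_ (sym ax*≡) (sym ay*≡) x⊏y)
    ... | headDeleted _ ax*≡ | headKept nd ay*≡   =
      inj₁ (subst₂ _⊏_ (sym ax*≡) (sym ay*≡) (⊏-trans x⊏y (tail-⊏-∷star y nd)))
    ... | headKept _ ax*≡    | headKept _ ay*≡    with x⊏ˢy
    ...   | inj₁ x*⊏y*           =
      inj₁ (subst₂ _⊏_ (sym ax*≡) (sym ay*≡) (ih (star-shorter² x y 0<|x| 0<|y|) x*⊏y*))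
    ...   | inj₂ (x*≡y* , x<ᶜy) =
      inj₂ (trans ax*≡ (trans (cong (a ∷_) x*≡y*) (sym ay*≡)) , ∷⁺-<ᶜ a a |x|≡|y| x<ᶜy)
    ∷⁺-⊏-sameLength 0<|x| 0<|y| |x|≡|y| x⊏ˢy | headKept _ ax*≡ | headDeleted nd ay*≡
      with x⊏ˢy | ∷star-⊑ a y 0<|y| nd
    ... | inj₁ x*⊏y* | ay*⊑y =
      inj₁ (subst₂ _⊏_ (sym ax*≡) (sym ay*≡) (⊏-⊑-trans (ih (star-shorter² x y 0<|x| 0<|y|) x*⊏y*) ay*⊑y))
    ... | inj₂ (x*≡y* , _) | inj₁ ay*⊏y =
      inj₁ (subst₂ _⊏_ (sym ax*≡) (sym ay*≡) (subst (λ z → a ∷ z ⊏ y) (sym x*≡y*) ay*⊏y))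
    ... | inj₂ (x*≡y* , x<ᶜy) | inj₂ ay*≡y =
      inj₂ (trans ax*≡ (trans (cong (a ∷_) x*≡y*) (trans ay*≡y (sym ay*≡))) , ∷⁺-<ᶜ a a |x|≡|y| x<ᶜy)

    ∷⁺-⊏-longer : length y <ℕ length x → star x ⊏ y → star (a ∷ x) ⊏ a ∷ y
    ∷⁺-⊏-longer |y|<|x| x*⊏y with star-∷-view a x
    ... | headKept _ ax*≡    = subst (_⊏ a ∷ y) (sym ax*≡) (ih (star-shorterˡ x y (ℕ.m<n⇒0<n |y|<|x|)) x*⊏y)
    ... | headDeleted _ ax*≡ = subst (_⊏ a ∷ y) (sym ax*≡) (⊏-trans x⊏y (tail-⊏ a y))

    ∷⁺-⊏-step : a ∷ x ⊏ a ∷ y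
    ∷⁺-⊏-step with ℕ.<-cmp (length x) (length y)
    ... | tri< |x|<|y| _ _ = ⊏-shorter⁺ (s≤s |x|<|y|) (∷⁺-⊏-shorter |x|<|y| (⊏-shorter⁻ |x|<|y| x⊏y))
    ... | tri≈ _ |x|≡|y| _ =
      ⊏-sameLength⁺ (s≤s z≤n) (cong suc |x|≡|y|)
        (∷⁺-⊏-sameLength 0<|x| (subst (0 <ℕ_) |x|≡|y| 0<|x|) |x|≡|y| (⊏-sameLength⁻ 0<|x| |x|≡|y| x⊏y))
      where 0<|x| = ⊏-sameLength-nonEmpty |x|≡|y| x⊏y
    ... | tri> _ _ |y|<|x| = ⊏-longer⁺ (s≤s |y|<|x|) (∷⁺-⊏-longer |y|<|x| (⊏-longer⁻ |y|<|x| x⊏y))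

  module _ (b : A) {x y : List A} (ih : Preserves⊏Below (_∷ʳ b) x y) (x⊏y : x ⊏ y) where

    ∷ʳ⁺-⊏-shorter : length x <ℕ length y → x ⊑ star y → x ∷ʳ b ⊑ star (y ∷ʳ b)
    ∷ʳ⁺-⊏-shorter |x|<|y| x⊑y* with star-∷ʳ-view y b
    ... | lastKept _ yb*≡      = subst (x ∷ʳ b ⊑_) (sym yb*≡) (Preserves⊏Below-⊑ x y ih smaller x⊑y*)
      where smaller = star-shorterʳ x y (ℕ.m<n⇒0<n |x|<|y|)
    ... | lastDeleted y>b yb*≡ =
      subst (x ∷ʳ b ⊑_) (sym yb*≡)
        (inj₁ (⊑-⊏-trans (Preserves⊏Below-⊑ x y ih smaller x⊑y*) (star∷ʳ-⊏ y 0<|y| y>b)))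
      where
      0<|y| = ℕ.m<n⇒0<n |x|<|y|
      smaller = star-shorterʳ x y 0<|y|

    ∷ʳ⁺-⊏-sameLength : 0 <ℕ length x → 0 <ℕ length y → x ⊏ˢ y → x ∷ʳ b ⊏ˢ y ∷ʳ b
    ∷ʳ⁺-⊏-sameLength 0<|x| 0<|y| x⊏ˢy with star-∷ʳ-view x b | star-∷ʳ-view y b
    ... | lastDeleted _ xb*≡ | lastDeleted _ yb*≡ = inj₁ (subst₂ _⊏_ (sym xb*≡) (sym yb*≡) x⊏y)
    ... | lastDeleted _ xb*≡ | lastKept y≯b yb*≡  =
      inj₁ (subst₂ _⊏_ (sym xb*≡) (sym yb*≡) (⊏-⊑-trans x⊏y (⊑-star∷ʳ y y≯b)))
    ... | lastKept _ xb*≡    | lastDeleted y>b yb*≡ =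
      inj₁ (subst₂ _⊏_ (sym xb*≡) (sym yb*≡) (⊑-⊏-trans (stars∷ʳ x⊏ˢy) (star∷ʳ-⊏ y 0<|y| y>b)))
      where
      stars∷ʳ : x ⊏ˢ y → star x ∷ʳ b ⊑ star y ∷ʳ b
      stars∷ʳ (inj₁ x*⊏y*)       = inj₁ (ih (star-shorter² x y 0<|x| 0<|y|) x*⊏y*)
      stars∷ʳ (inj₂ (x*≡y* , _)) = inj₂ (cong (_∷ʳ b) x*≡y*)
    ... | lastKept _ xb*≡    | lastKept _ yb*≡    with x⊏ˢy
    ...   | inj₁ x*⊏y*           =
      inj₁ (subst₂ _⊏_ (sym xb*≡) (sym yb*≡) (ih (star-shorter² x y 0<|x| 0<|y|) x*⊏y*))
    ...   | inj₂ (x*≡y* , x<ᶜy) =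
      inj₂ (trans xb*≡ (trans (cong (_∷ʳ b) x*≡y*) (sym yb*≡)) , ∷ʳ⁺-<ᶜ b x<ᶜy)

    ∷ʳ⁺-⊏-longer : length y <ℕ length x → star x ⊏ y → star (x ∷ʳ b) ⊏ y ∷ʳ b
    ∷ʳ⁺-⊏-longer |y|<|x| x*⊏y with star-∷ʳ-view x b
    ... | lastKept _ xb*≡    = subst (_⊏ y ∷ʳ b) (sym xb*≡) (ih (star-shorterˡ x y (ℕ.m<n⇒0<n |y|<|x|)) x*⊏y)
    ... | lastDeleted _ xb*≡ = subst (_⊏ y ∷ʳ b) (sym xb*≡) (⊏-trans x⊏y (init-⊏ y b))

    ∷ʳ⁺-⊏-step : x ∷ʳ b ⊏ y ∷ʳ b
    ∷ʳ⁺-⊏-step with ℕ.<-cmp (length x) (length y)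
    ... | tri< |x|<|y| _ _ =
      ⊏-shorter⁺ (length-∷ʳ-< x y |x|<|y|) (∷ʳ⁺-⊏-shorter |x|<|y| (⊏-shorter⁻ |x|<|y| x⊏y))
    ... | tri≈ _ |x|≡|y| _ =
      ⊏-sameLength⁺ (0<length-∷ʳ x b) (trans (length-∷ʳ x b) (trans (cong suc |x|≡|y|) (sym (length-∷ʳ y b))))
        (∷ʳ⁺-⊏-sameLength 0<|x| (subst (0 <ℕ_) |x|≡|y| 0<|x|) (⊏-sameLength⁻ 0<|x| |x|≡|y| x⊏y))
      where 0<|x| = ⊏-sameLength-nonEmpty |x|≡|y| x⊏y
    ... | tri> _ _ |y|<|x| =
      ⊏-longer⁺ (length-∷ʳ-< y x |y|<|x|) (∷ʳ⁺-⊏-longer |y|<|x| (⊏-longer⁻ |y|<|x| x⊏y))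

  ∷⁺-⊏ : ∀ a {x y} → x ⊏ y → a ∷ x ⊏ a ∷ y
  ∷⁺-⊏ a = ⊏-preserved-bySizeInduction (a ∷_) (∷⁺-⊏-step a)

  ∷ʳ⁺-⊏ : ∀ b {x y} → x ⊏ y → x ∷ʳ b ⊏ y ∷ʳ b
  ∷ʳ⁺-⊏ b = ⊏-preserved-bySizeInduction (_∷ʳ b) (∷ʳ⁺-⊏-step b)

  ++⁺ˡ-⊏ : ∀ u {x y} → x ⊏ y → u ++ x ⊏ u ++ y
  ++⁺ˡ-⊏ []      x⊏y = x⊏y
  ++⁺ˡ-⊏ (a ∷ u) x⊏y = ∷⁺-⊏ a (++⁺ˡ-⊏ u x⊏y)

  ++⁺ʳ-⊏ : ∀ v {x y} → x ⊏ y → x ++ v ⊏ y ++ v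
  ++⁺ʳ-⊏ []      {x} {y} x⊏y = subst₂ _⊏_ (sym (++-identityʳ x)) (sym (++-identityʳ y)) x⊏y
  ++⁺ʳ-⊏ (b ∷ v) {x} {y} x⊏y =
    subst₂ _⊏_ (++-assoc x [ b ] v) (++-assoc y [ b ] v) (++⁺ʳ-⊏ v (∷ʳ⁺-⊏ b x⊏y))

  -- The chain order is V-order

  iter-suc : ∀ n w → iter (suc n) w ≡ iter n (star w)
  iter-suc zero    w = refl
  iter-suc (suc n) w = cong star (iter-suc n w)

  iter-+ : ∀ m n w → iter (m + n) w ≡ iter m (iter n w)
  iter-+ zero    n w = refl
  iter-+ (suc m) n w = cong star (iter-+ m n w)

  length-iter : ∀ s w → length (iter s w) ≡ length w ∸ s
  length-iter zero    w = refl
  length-iter (suc s) w =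
    trans (length-star (iter s w)) (trans (cong pred (length-iter s w)) (ℕ.pred[m∸n]≡m∸[1+n] (length w) s))

  length-iter-antitone : ∀ {i j} w → i ≤ j → length (iter j w) ≤ length (iter i w)
  length-iter-antitone {i} {j} w i≤j =
    subst₂ _≤_ (sym (length-iter j w)) (sym (length-iter i w)) (ℕ.∸-monoʳ-≤ (length w) i≤j)

  iter-exhausted : ∀ s w → length w ≤ s → iter s w ≡ []
  iter-exhausted s w |w|≤s with iter s w | length-iter s w
  ... | []    | _       = refl
  ... | _ ∷ _ | |iter|≡ with () ← trans |iter|≡ (ℕ.m≤n⇒m∸n≡0 |w|≤s)

  iter-byLength : ∀ k w → iter k w ≡ iter (length w ∸ length (iter k w)) w
  iter-byLength k w with k ℕ.≤? length w
  ... | yes k≤|w| =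
    cong (λ j → iter j w) (sym (trans (cong (length w ∸_) (length-iter k w)) (ℕ.m∸[m∸n]≡n k≤|w|)))
  ... | no  k≰|w| = trans (iter-exhausted k w |w|≤k) (sym (iter-exhausted _ w (ℕ.≤-reflexive (sym |w|∸|iter|≡|w|))))
    where
    |w|≤k = ℕ.<⇒≤ (ℕ.≰⇒> k≰|w|)
    |w|∸|iter|≡|w| : length w ∸ length (iter k w) ≡ length w
    |w|∸|iter|≡|w| = cong (length w ∸_) (trans (length-iter k w) (ℕ.m≤n⇒m∸n≡0 |w|≤k))

  iter-length-injective : ∀ i j w → length (iter i w) ≡ length (iter j w) → iter i w ≡ iter j w
  iter-length-injective i j w |i|≡|j| =
    trans (iter-byLength i w) (trans (cong (λ ℓ → iter (length w ∸ ℓ) w) |i|≡|j|) (sym (iter-byLength j w)))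

  iter-≡-belowMeet : ∀ {i j s t} x y → iter i x ≡ iter j y →
    length (iter s x) ≡ length (iter t y) → length (iter s x) ≤ length (iter i x) → iter s x ≡ iter t y
  iter-≡-belowMeet {i} {j} {s} {t} x y meet |s|≡|t| |s|≤|i| = begin
    iter s x          ≡⟨ iter-length-injective s (m + i) x (sym (trans (cong length (iter-+ m i x)) |iter-m|)) ⟩
    iter (m + i) x    ≡⟨ iter-+ m i x ⟩
    iter m (iter i x) ≡⟨ cong (iter m) meet ⟩
    iter m (iter j y) ≡⟨ iter-+ m j y ⟨
    iter (m + j) y    ≡⟨ iter-length-injective (m + j) t y (trans (cong length (iter-+ m j y))
                           (trans (cong (length ∘ iter m) (sym meet)) (trans |iter-m| |s|≡|t|))) ⟩
    iter t y          ∎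
    where
    open ≡-Reasoning
    m = length (iter i x) ∸ length (iter s x)
    |iter-m| : length (iter m (iter i x)) ≡ length (iter s x)
    |iter-m| = trans (length-iter m (iter i x)) (ℕ.m∸[m∸n]≡n |s|≤|i|)

  star-⊑ : ∀ z → star z ⊑ z
  star-⊑ []      = inj₂ refl
  star-⊑ (c ∷ z) = inj₁ (⊏-shorter⁺ (star-shorter (c ∷ z) (s≤s z≤n)) (inj₂ refl))

  iter-⊑ : ∀ s w → iter s w ⊑ w
  iter-⊑ zero    w = inj₂ refl
  iter-⊑ (suc s) w = ⊑-trans (star-⊑ (iter s w)) (iter-⊑ s w)

  chain-star-prefix : ∀ z → ∃[ R ] chain z ≡ chain (star z) ++ R
  chain-star-prefix []      = [] , refl
  chain-star-prefix (c ∷ z) = [ c ∷ z ] , chain-star (c ∷ z) (s≤s z≤n)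

  chain-iter : ∀ s x → ∃[ R ] chain x ≡ chain (iter s x) ++ R
  chain-iter zero    x = [] , sym (++-identityʳ (chain x))
  chain-iter (suc s) x with chain-iter s x | chain-star-prefix (iter s x)
  ... | R , cx≡ | R′ , cz≡ =
    R′ ++ R , trans cx≡ (trans (cong (_++ R) cz≡) (++-assoc (chain (iter (suc s) x)) R′ R))

  ⊏-fromIterates : ∀ s t {x y} → length (iter s x) ≡ length (iter t y) → iter s x ⊏ iter t y → x ⊏ y
  ⊏-fromIterates s t {x} {y} |X|≡|Y| (chainLex X⊏Y) with chain-iter s x | chain-iter t y
  ... | R , cx≡ | R′ , cy≡ =
    chainLex (subst₂ Lexᶜ (sym cx≡) (sym cy≡)
      (++⁺ʳ-Lex R R′ (trans (length-chain (iter s x)) (trans |X|≡|Y| (sym (length-chain (iter t y))))) X⊏Y))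

  chain-split : ∀ x {ps X} us → chain x ≡ ps ++ X ∷ us →
    iter (length us) x ≡ X × chain (star X) ≡ ps × 0 <ℕ length X
  chain-split x us = bounded (length x) x us refl
    where
    bounded : ∀ n x {ps X} us → length x ≡ n → chain x ≡ ps ++ X ∷ us →
      iter (length us) x ≡ X × chain (star X) ≡ ps × 0 <ℕ length X
    bounded zero    []      {[]}    _  _ ()
    bounded zero    []      {_ ∷ _} _  _ ()
    bounded (suc n) (c ∷ x) {ps} {X} us |x|≡ cx≡ with initLast us
    ... | [] with ∷ʳ-injective (chain (star (c ∷ x))) ps (trans (sym (chain-star (c ∷ x) (s≤s z≤n))) cx≡)
    ...   | cx*≡ , refl = refl , cx*≡ , s≤s z≤n
    bounded (suc n) (c ∷ x) {ps} {X} .(us ∷ʳ u) |x|≡ cx≡ | us ∷ʳ′ u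
      with bounded n (star (c ∷ x)) us (trans (length-star-∷ c x) (ℕ.suc-injective |x|≡))
             (∷ʳ-injectiveˡ (chain (star (c ∷ x))) (ps ++ X ∷ us)
               (trans (sym (chain-star (c ∷ x) (s≤s z≤n))) (trans cx≡ (sym (++-assoc ps (X ∷ us) [ u ])))))
    ... | iter≡X , cX*≡ , 0<|X| =
      trans (cong (λ k → iter k (c ∷ x)) (length-∷ʳ us u)) (trans (iter-suc (length us) (c ∷ x)) iter≡X) ,
      cX*≡ , 0<|X|

  LastDiffLess-nonEmpty : ∀ {u v} → LastDiffLess u v → 0 <ℕ length u
  LastDiffLess-nonEmpty (p , _ , c , _ , w , refl , _) = subst (0 <ℕ_) (sym (length-++-sucʳ p c w)) (s≤s z≤n)

  ≺⇒⊏ : ∀ {x y} → x ≺ y → x ⊏ y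
  ≺⇒⊏ {x} {y} (x≢y , inj₁ (s , iter≡x)) with subst (_⊑ y) iter≡x (iter-⊑ s y)
  ... | inj₁ x⊏y = x⊏y
  ... | inj₂ x≡y = ⊥-elim (x≢y x≡y)
  ≺⇒⊏ (_ , inj₂ (_ , _ , s , t , (meet , _) , ldl)) with LastDiffLess⇒<ᶜ ldl
  ... | X<ᶜY , |X|≡|Y| =
    ⊏-fromIterates s t |X|≡|Y| (⊏-sameLength⁺ (LastDiffLess-nonEmpty ldl) |X|≡|Y| (inj₂ (meet , X<ᶜY)))

  chainPrefix⇒Occurs : ∀ {x y Y} zs → chain y ≡ chain x ++ Y ∷ zs → Occurs x y
  chainPrefix⇒Occurs {[]}    {y} _  _   = length y , iter-exhausted (length y) y ℕ.≤-refl
  chainPrefix⇒Occurs {c ∷ x} {y} {Y} zs cy≡ =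
    suc (length zs) , proj₁ (chain-split y (Y ∷ zs)
      (trans cy≡ (trans (cong (_++ Y ∷ zs) (chain-star (c ∷ x) (s≤s z≤n)))
                        (++-assoc (chain (star (c ∷ x))) [ c ∷ x ] (Y ∷ zs)))))

  -- Any earlier meeting of the two star sequences would force x^{s*} ≡ y^{t*}.
  firstDifference⇒meet : ∀ {x y ps X Y} us vs → chain x ≡ ps ++ X ∷ us → chain y ≡ ps ++ Y ∷ vs → X <ᶜ Y →
    ¬ Occurs x y × MinMeet x y (length us) (length vs) × LastDiffLess (iter (length us) x) (iter (length vs) y)
  firstDifference⇒meet {x} {y} us vs cx≡ cy≡ X<ᶜY with chain-split x us cx≡ | chain-split y vs cy≡
  ... | refl , cX*≡ps , 0<|X| | refl , cY*≡ps , 0<|Y| = ¬x∈y , (meet , minimal) , <ᶜ⇒LastDiffLess |X|≡|Y| X<ᶜY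
    where
    s = length us
    t = length vs
    meet : iter (suc s) x ≡ iter (suc t) y
    meet = chain-injective (trans cX*≡ps (sym cY*≡ps))
    |X|≡|Y| : length (iter s x) ≡ length (iter t y)
    |X|≡|Y| = trans (sym (suc-length-star (iter s x) 0<|X|))
                (trans (cong (suc ∘ length) meet) (suc-length-star (iter t y) 0<|Y|))
    noMeetAbove : ∀ i j → iter i x ≡ iter j y → length (iter s x) ≤ length (iter i x) → ⊥
    noMeetAbove i j meet′ |X|≤ = <ᶜ-irrefl (iter-≡-belowMeet {i} {j} {s} {t} x y meet′ |X|≡|Y| |X|≤) X<ᶜY
    ¬x∈y : ¬ Occurs x y
    ¬x∈y (k , iter≡x) = noMeetAbove 0 k (sym iter≡x) (length-iter-antitone {0} {s} x z≤n)
    minimal : ∀ s′ t′ → iter (suc s′) x ≡ iter (suc t′) y → s ≤ s′ × t ≤ t′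
    minimal s′ t′ meet′ = ℕ.≮⇒≥ (noMeetAbove′ ∘ length-iter-antitone x) , ℕ.≮⇒≥ (noMeetAbove′ ∘ via-y)
      where
      noMeetAbove′ = noMeetAbove (suc s′) (suc t′) meet′
      via-y : t′ <ℕ t → length (iter s x) ≤ length (iter (suc s′) x)
      via-y t′<t = subst₂ _≤_ (sym |X|≡|Y|) (cong length (sym meet′)) (length-iter-antitone y t′<t)

  ⊏⇒¬Occurs : ∀ {x y} → x ⊏ y → ¬ Occurs y x
  ⊏⇒¬Occurs {x} x⊏y (s , iter≡y) = ⊏-irrefl refl (⊏-⊑-trans x⊏y (subst (_⊑ x) iter≡y (iter-⊑ s x)))

  ⊏⇒≺ : ∀ {x y} → x ⊏ y → x ≺ y
  ⊏⇒≺ x⊏y with Lex-split (_⊏_.lex x⊏y)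
  ... | inj₁ (_ , zs , cy≡) = (λ x≡y → ⊏-irrefl x≡y x⊏y) , inj₁ (chainPrefix⇒Occurs zs cy≡)
  ... | inj₂ (_ , _ , _ , us , vs , cx≡ , cy≡ , X<ᶜY) with firstDifference⇒meet us vs cx≡ cy≡ X<ᶜY
  ...   | ¬x∈y , minMeet , ldl =
    (λ x≡y → ⊏-irrefl x≡y x⊏y) , inj₂ (¬x∈y , ⊏⇒¬Occurs x⊏y , length us , length vs , minMeet , ldl)

  ++⁺-⊏ : ∀ u v {x y} → x ⊏ y → u ++ x ++ v ⊏ u ++ y ++ v
  ++⁺-⊏ u v = ++⁺ˡ-⊏ u ∘ ++⁺ʳ-⊏ v

  ++⁻-⊏ : ∀ u v {x y} → u ++ x ++ v ⊏ u ++ y ++ v → x ⊏ y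
  ++⁻-⊏ u v = strictlyMonotone⇒reflecting ⊏-isStrictTotalOrder
    (IsStrictTotalOrder.isStrictPartialOrder ⊏-isStrictTotalOrder) (λ z → u ++ z ++ v) (++⁺-⊏ u v)

-- The alphabet need not be finite.
theorem2 : ∀ {a ℓ} {A : Set a} {_<_ : Rel A ℓ}
    (sto : IsStrictTotalOrder _≡_ _<_) →
    (finite : ∃ λ (n : ℕ) → A ↔ Fin n) →
    (u v x y : List A) →
    VOrder._≺_ sto x y ⇔ VOrder._≺_ sto (u ++ x ++ v) (u ++ y ++ v)
theorem2 sto _ u v x y = mk⇔ (⊏⇒≺ ∘ ++⁺-⊏ u v ∘ ≺⇒⊏) (⊏⇒≺ ∘ ++⁻-⊏ u v ∘ ≺⇒⊏)
  where open VOrderProperties sto
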